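{- If $G$ is a simple graph with no loops and $v$ is any vertex of $G$, then \[ T_{G+v}=\frac{zT_G+2z^2T_{G-v}}{z+1}. \]
   Context: Adjacency matrix of a looped simple graph over $\mathbb{F}_2$: $M_{uv}=1$ iff distinct $u,v$ adjacent, $M_{vv}=1$ iff $v$ has a loop; $M[S]$ principal submatrix, $M[\emptyset]$ nonsingular by convention. $D(G)=(V(G),\{S:M[S]\text{ nonsingular}\})$. For a set system $D=(E,\mathcal{F})$: $D*A=(E,\{X\triangle A:X\in\mathcal{F}\})$, $w(D)=\max_{F\in\mathcal{F}}|F|-\min_{F\in\mathcal{F}}|F|$, $T_D(z)=\sum_{A\subseteq E}z^{w(D*A)}$, $T_G=T_{D(G)}$; the empty graph has twist polynomial $1$. $G+v$ is $G$ with a loop added at $v$ (loop complementation), $G-v$ vertex deletion. -}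

module Defs where

open import Data.Bool using (Bool; true; false; not; _xor_; _∧_; if_then_else_)
open import Data.Nat using (ℕ; zero; suc; _+_; _∸_; _^_; _⊔_; _⊓_)
open import Data.Fin using (Fin; zero; suc; punchIn; _≟_)
open import Data.Vec using (Vec; []; _∷_; zipWith)
open import Data.List using (List; []; _∷_; map; foldr; _++_)
open import Data.Nat.ListAction using (sum)
open import Data.Product using (_×_; _,_)
open import Relation.Nullary using (does)
open import Relation.Binary.PropositionalEquality using (_≡_)

Subset : ℕ → Set
Subset n = Vec Bool n

card : ∀ {n} → Subset n → ℕ
card []           = 0
card (true ∷ s)  = suc (card s)
card (false ∷ s) = card s

_△_ : ∀ {n} → Subset n → Subset n → Subset n
X △ A = zipWith _xor_ X A

allSubsets : (n : ℕ) → List (Subset n)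
allSubsets zero    = [] ∷ []
allSubsets (suc n) = map (true ∷_) (allSubsets n) ++ map (false ∷_) (allSubsets n)

elems : ∀ {n} → Subset n → List (Fin n)
elems []           = []
elems (true ∷ s)  = zero ∷ map suc (elems s)
elems (false ∷ s) = map suc (elems s)

picks : ∀ {A : Set} → List A → List (A × List A)
picks []       = []
picks (x ∷ xs) = (x , xs) ∷ map (λ { (y , ys) → (y , x ∷ ys) }) (picks xs)

xorAll : List Bool → Bool
xorAll = foldr _xor_ false

-- Determinant over F₂ of the submatrix of M with rows rs and columns cs
-- (in the given orders), by Laplace expansion along the first row;
-- signs are irrelevant in characteristic 2.  The empty matrix has det 1.
detF2 : ∀ {n} → (Fin n → Fin n → Bool) → List (Fin n) → List (Fin n) → Bool
detF2 M []       []       = true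
detF2 M []       (_ ∷ _)  = false
detF2 M (_ ∷ _)  []       = false
detF2 M (r ∷ rs) cs@(_ ∷ _) =
  xorAll (map (λ { (c , cs') → M r c ∧ detF2 M rs cs' }) (picks cs))

nonsingular : ∀ {n} → (Fin n → Fin n → Bool) → Subset n → Bool
nonsingular M S = detF2 M (elems S) (elems S)

record Graph (n : ℕ) : Set where
  field
    adj     : Fin n → Fin n → Bool
    adjSym  : ∀ u v → adj u v ≡ adj v u
    adjIrr  : ∀ v → adj v v ≡ false
    loop    : Fin n → Bool
open Graph public

adjMatrix : ∀ {n} → Graph n → Fin n → Fin n → Bool
adjMatrix G u v = if does (u ≟ v) then loop G u else adj G u v

Loopless : ∀ {n} → Graph n → Set
Loopless G = ∀ v → loop G v ≡ false

_+ℓ_ : ∀ {n} → Graph n → Fin n → Graph n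
G +ℓ v = record
  { adj = adj G ; adjSym = adjSym G ; adjIrr = adjIrr G
  ; loop = λ u → if does (u ≟ v) then not (loop G u) else loop G u }

_─_ : ∀ {n} → Graph (suc n) → Fin (suc n) → Graph n
G ─ v = record
  { adj    = λ i j → adj G (punchIn v i) (punchIn v j)
  ; adjSym = λ i j → adjSym G (punchIn v i) (punchIn v j)
  ; adjIrr = λ i → adjIrr G (punchIn v i)
  ; loop   = λ i → loop G (punchIn v i) }

SetSystem : ℕ → Set
SetSystem n = Subset n → Bool

D : ∀ {n} → Graph n → SetSystem n
D G S = nonsingular (adjMatrix G) S

filterB : ∀ {A : Set} → (A → Bool) → List A → List A
filterB p []       = []
filterB p (x ∷ xs) = if p x then x ∷ filterB p xs else filterB p xs

feasibles : ∀ {n} → SetSystem n → List (Subset n)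
feasibles {n} F = filterB F (allSubsets n)

_*tw_ : ∀ {n} → SetSystem n → Subset n → SetSystem n
(F *tw A) X = F (X △ A)

maxL : List ℕ → ℕ
maxL = foldr _⊔_ 0

minL : List ℕ → ℕ
minL []       = 0
minL (x ∷ xs) = foldr _⊓_ x xs

width : ∀ {n} → SetSystem n → ℕ
width F = maxL (map card (feasibles F)) ∸ minL (map card (feasibles F))

twistPoly : ∀ {n} → SetSystem n → ℕ → ℕ
twistPoly {n} F z = sum (map (λ A → z ^ width (F *tw A)) (allSubsets n))

T : ∀ {n} → Graph n → ℕ → ℕ
T G = twistPoly (D G)

-- Let F₀ = D(G − v) and let P consist of the S with S + v feasible in D(G). The feasible sets of
-- D(G) and D(G + v) avoiding v are those of F₀; those containing v come from P, respectively from
-- F₀ ⊕ P, because toggling the loop at v adds det M[S] to det M[S + v] over F₂. As G is loopless,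
-- every set of F₀ has even size (alternating matrices have no odd nonsingular principal minors),
-- and expanding along row v shows that every set of P is a set of F₀ plus one vertex, hence odd.
-- So for a twist A avoiding v, if the sizes |S △ A| over F₀ range over [l, h], then over D(G) they
-- range over [l, H] with H ∈ {h, h + 2}, and over D(G + v) over [l, max(H, h + 1)]; in both cases
-- (z + 1) z^w(D(G+v)*A) = z z^w(D(G)*A) + z² z^w(F₀*(A−v)). Complementing A preserves widths, which
-- gives the twists containing v, and summing over A, where each A − v occurs twice, proves the formula.

module Submission where

open import Defs
open import Data.Bool using (Bool; true; false; not; _xor_; _∧_; if_then_else_)
open import Data.Bool.Properties
  using ( xor-assoc; xor-same; xor-identityʳ; not-distribʳ-xor; xor-∧-commutativeRing
        ; ∧-assoc; ∧-idem; ∧-zeroʳ; ∧-conicalʳ; ∧-commutativeMonoid)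
open import Data.Fin using (Fin; zero; suc; punchIn; _≟_)
open import Data.Fin.Properties using (punchIn-injective; punchInᵢ≢i)
open import Data.List using (List; []; _∷_; map; length; foldr; _++_)
open import Data.List.Membership.Propositional using (_∈_)
open import Data.List.Membership.Propositional.Properties using (∈-map⁺; ∈-map⁻; ∈-++⁺ˡ; ∈-++⁺ʳ)
open import Data.List.Properties using (map-∘; map-cong; length-map; map-++)
open import Data.Nat.ListAction using (sum)
open import Data.Nat.ListAction.Properties using (sum-++)
open import Data.List.Relation.Unary.All as All using (All; []; _∷_)
open import Data.List.Relation.Unary.All.Properties using (map⁺)
open import Data.List.Relation.Unary.Any using (here; there)
open import Data.List.Relation.Binary.Permutation.Propositional using (_↭_; refl; prep; swap; trans; ↭-reflexive)
open import Data.List.Relation.Binary.Permutation.Propositional.Properties using () renaming (map⁺ to ↭-map⁺)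
open import Data.Vec using ([]; _∷_; insertAt; removeAt; lookup; replicate; _[_]≔_)
open import Data.Nat using (ℕ; zero; suc; parity; _+_; _≤_; s≤s; z≤n; _⊔_; _⊓_; _∸_; _*_; _^_)
open import Data.Parity.Base as ℙ using (0ℙ; 1ℙ; _⁻¹)
open import Data.Parity.Properties using (p≢p⁻¹; ⁻¹-selfInverse; ⁻¹-involutive; suc-homo-⁻¹)
open import Data.Fin.Subset using (∁)
open import Data.Nat.Properties using (suc-injective; +-suc; n≤1+n; ≤-refl; ≤-trans; ≤-antisym;
  m≤m⊔n; m≤n⊔m; ⊔-lub; ⊔-sel; ⊔-identityʳ; m⊓n≤m; m⊓n≤n; ⊓-sel;
  +-comm; [m+n]∸[m+o]≡n∸o; +-cancelˡ-≤; +-monoˡ-≤; m≤n⇒m<n∨m≡n; +-∸-assoc;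
  *-zeroʳ; *-distribˡ-+; +-identityʳ; +-commutativeSemigroup)
open import Algebra.Properties.CommutativeSemigroup +-commutativeSemigroup using () renaming (interchange to +-interchange)
open import Data.Nat.Tactic.RingSolver using (solve-∀)
open import Data.Vec.Properties using (insertAt-lookup; removeAt-insertAt; insertAt-removeAt; map-insertAt)
open import Data.Product using (_×_; _,_; proj₁; proj₂; ∃-syntax)
open import Data.Sum using (_⊎_; inj₁; inj₂)
open import Function using (_∘_; id)
open import Relation.Nullary using (contradiction; yes; no)
open import Relation.Binary.PropositionalEquality as ≡ using (_≡_; _≢_; refl; sym; cong; cong₂; module ≡-Reasoning)
open import Algebra.Bundles using (CommutativeRing; CommutativeMonoid)
open import Algebra.Properties.CommutativeSemigroup
  (CommutativeRing.+-commutativeSemigroup xor-∧-commutativeRing)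
  using () renaming (interchange to xor-interchange; x∙yz≈y∙xz to xor-left-comm)
open import Algebra.Properties.CommutativeSemigroup
  (CommutativeMonoid.commutativeSemigroup ∧-commutativeMonoid) using () renaming (x∙yz≈y∙xz to ∧-left-comm)

⨁ : {A : Set} → List A → (A → Bool) → Bool
⨁ xs f = xorAll (map f xs)

module _ {A : Set} where

  ⨁-cong : ∀ (xs : List A) {f g : A → Bool} → (∀ x → f x ≡ g x) → ⨁ xs f ≡ ⨁ xs g
  ⨁-cong xs f≗g = cong xorAll (map-cong f≗g xs)

  ⨁-cong-local : ∀ {xs : List A} {f g : A → Bool} → All (λ x → f x ≡ g x) xs → ⨁ xs f ≡ ⨁ xs g
  ⨁-cong-local []       = refl
  ⨁-cong-local (e ∷ es) = cong₂ _xor_ e (⨁-cong-local es)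

  ⨁-false : ∀ (xs : List A) → ⨁ xs (λ _ → false) ≡ false
  ⨁-false []       = refl
  ⨁-false (_ ∷ xs) = ⨁-false xs

  ⨁-xor : ∀ (xs : List A) (f g : A → Bool) → ⨁ xs (λ x → f x xor g x) ≡ ⨁ xs f xor ⨁ xs g
  ⨁-xor []       f g = refl
  ⨁-xor (x ∷ xs) f g = ≡.trans (cong ((f x xor g x) xor_) (⨁-xor xs f g)) (xor-interchange (f x) (g x) _ _)

  ∧-distribˡ-⨁ : ∀ b (xs : List A) (f : A → Bool) → b ∧ ⨁ xs f ≡ ⨁ xs (λ x → b ∧ f x)
  ∧-distribˡ-⨁ true  xs f = refl
  ∧-distribˡ-⨁ false xs f = sym (⨁-false xs)

  ⨁-witness : ∀ {Q : A → Set} {xs} (f : A → Bool) → All Q xs → ⨁ xs f ≡ true → ∃[ x ] Q x × f x ≡ true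
  ⨁-witness {xs = x ∷ xs} f (Qx ∷ Qxs) s with f x in fx
  ... | true  = x , Qx , fx
  ... | false = ⨁-witness f Qxs s

⨁-map : ∀ {A B : Set} (xs : List A) (h : A → B) (f : B → Bool) → ⨁ (map h xs) f ≡ ⨁ xs (f ∘ h)
⨁-map xs h f = cong xorAll (sym (map-∘ xs))

⨁-comm : ∀ {A B : Set} (xs : List A) (ys : List B) (f : A → B → Bool) →
  ⨁ xs (λ x → ⨁ ys (f x)) ≡ ⨁ ys (λ y → ⨁ xs (λ x → f x y))
⨁-comm []       ys f = sym (⨁-false ys)
⨁-comm (x ∷ xs) ys f =
  ≡.trans (cong (⨁ ys (f x) xor_) (⨁-comm xs ys f)) (sym (⨁-xor ys (f x) _))

-- Off-diagonal terms of a symmetric double sum cancel in pairs.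
⨁-diagonal : ∀ {A : Set} (xs : List A) (g : A → A → Bool) → (∀ x y → g x y ≡ g y x) →
  ⨁ xs (λ x → ⨁ xs (g x)) ≡ ⨁ xs (λ x → g x x)
⨁-diagonal []       g sym-g = refl
⨁-diagonal (x ∷ xs) g sym-g = begin
  (g x x xor row) xor ⨁ xs (λ y → g y x xor ⨁ xs (g y))
    ≡⟨ cong ((g x x xor row) xor_) (⨁-xor xs (λ y → g y x) _) ⟩
  (g x x xor row) xor (column xor rest)
    ≡⟨ cong (λ c → (g x x xor row) xor (c xor rest)) (⨁-cong xs (λ y → sym-g y x)) ⟩
  (g x x xor row) xor (row xor rest)
    ≡⟨ xor-assoc (g x x) row _ ⟩
  g x x xor (row xor (row xor rest))
    ≡⟨ cong (g x x xor_) (≡.trans (sym (xor-assoc row row rest)) (cong (_xor rest) (xor-same row))) ⟩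
  g x x xor rest
    ≡⟨ cong (g x x xor_) (⨁-diagonal xs g sym-g) ⟩
  g x x xor ⨁ xs (λ y → g y y)
    ∎
  where
  open ≡-Reasoning
  row    = ⨁ xs (g x)
  column = ⨁ xs (λ y → g y x)
  rest   = ⨁ xs (λ y → ⨁ xs (g y))

⨁-picks-∷ : ∀ {A : Set} (c : A) cs (f : A × List A → Bool) →
  ⨁ (picks (c ∷ cs)) f ≡ f (c , cs) xor ⨁ (picks cs) (λ p → f (proj₁ p , c ∷ proj₂ p))
⨁-picks-∷ c cs f = cong (f (c , cs) xor_) (⨁-map (picks cs) _ f)

⨁-picks²-flip : ∀ {A : Set} (h : A → A → List A → Bool) cs →
  ⨁ (picks cs) (λ p → ⨁ (picks (proj₂ p)) (λ q → h (proj₁ p) (proj₁ q) (proj₂ q))) ≡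
  ⨁ (picks cs) (λ p → ⨁ (picks (proj₂ p)) (λ q → h (proj₁ q) (proj₁ p) (proj₂ q)))
⨁-picks²-flip h []       = refl
⨁-picks²-flip h (x ∷ ys) = begin
  ⨁ (picks (x ∷ ys)) (λ p → ⨁ (picks (proj₂ p)) (λ q → h (proj₁ p) (proj₁ q) (proj₂ q)))
    ≡⟨ ⨁-picks-∷ x ys (λ p → ⨁ (picks (proj₂ p)) (λ q → h (proj₁ p) (proj₁ q) (proj₂ q))) ⟩
  first xor ⨁ (picks ys) (λ p → ⨁ (picks (x ∷ proj₂ p)) (λ q → h (proj₁ p) (proj₁ q) (proj₂ q)))
    ≡⟨ cong (first xor_) (split h) ⟩
  first xor (second xor rest h)
    ≡⟨ cong (λ r → first xor (second xor r)) (⨁-picks²-flip (λ a b r → h a b (x ∷ r)) ys) ⟩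
  first xor (second xor rest (λ a b → h b a))
    ≡⟨ xor-left-comm first second _ ⟩
  second xor (first xor rest (λ a b → h b a))
    ≡⟨ cong (second xor_) (sym (split (λ a b → h b a))) ⟩
  second xor ⨁ (picks ys) (λ p → ⨁ (picks (x ∷ proj₂ p)) (λ q → h (proj₁ q) (proj₁ p) (proj₂ q)))
    ≡⟨ sym (⨁-picks-∷ x ys (λ p → ⨁ (picks (proj₂ p)) (λ q → h (proj₁ q) (proj₁ p) (proj₂ q)))) ⟩
  ⨁ (picks (x ∷ ys)) (λ p → ⨁ (picks (proj₂ p)) (λ q → h (proj₁ q) (proj₁ p) (proj₂ q)))
    ∎
  where
  open ≡-Reasoning
  first  = ⨁ (picks ys) (λ q → h x (proj₁ q) (proj₂ q))
  second = ⨁ (picks ys) (λ p → h (proj₁ p) x (proj₂ p))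
  rest : (_ → _ → List _ → Bool) → Bool
  rest k = ⨁ (picks ys) (λ p → ⨁ (picks (proj₂ p)) (λ q → k (proj₁ p) (proj₁ q) (x ∷ proj₂ q)))
  split : ∀ k → ⨁ (picks ys) (λ p → ⨁ (picks (x ∷ proj₂ p)) (λ q → k (proj₁ p) (proj₁ q) (proj₂ q)))
              ≡ ⨁ (picks ys) (λ p → k (proj₁ p) x (proj₂ p)) xor rest k
  split k = ≡.trans (⨁-cong (picks ys) (λ p → ⨁-picks-∷ x (proj₂ p) (λ q → k (proj₁ p) (proj₁ q) (proj₂ q))))
                    (⨁-xor (picks ys) _ _)

Matrix : ℕ → Set
Matrix n = Fin n → Fin n → Bool

Symmetric : ∀ {n} → Matrix n → Set
Symmetric M = ∀ i j → M i j ≡ M j i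

module _ {n : ℕ} where

  detF2-∷ : ∀ (M : Matrix n) r rs cs →
    detF2 M (r ∷ rs) cs ≡ ⨁ (picks cs) (λ p → M r (proj₁ p) ∧ detF2 M rs (proj₂ p))
  detF2-∷ M r rs []      = refl
  detF2-∷ M r rs (_ ∷ _) = refl

  detF2-cong-rows : ∀ (M N : Matrix n) {rs} → All (λ r → ∀ c → M r c ≡ N r c) rs →
    ∀ cs → detF2 M rs cs ≡ detF2 N rs cs
  detF2-cong-rows M N []       []      = refl
  detF2-cong-rows M N []       (_ ∷ _) = refl
  detF2-cong-rows M N (_ ∷ _)  []      = refl
  detF2-cong-rows M N {r ∷ rs} (e ∷ es) cs@(_ ∷ _) =
    ⨁-cong (picks cs) (λ p → cong₂ _∧_ (e (proj₁ p)) (detF2-cong-rows M N es (proj₂ p)))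

  detF2-cong : ∀ (M N : Matrix n) → (∀ i j → M i j ≡ N i j) → ∀ rs cs → detF2 M rs cs ≡ detF2 N rs cs
  detF2-cong M N M≗N rs = detF2-cong-rows M N (All.universal (λ r → M≗N r) rs)

  detF2-expandColumn : ∀ (M : Matrix n) rs c cs →
    detF2 M rs (c ∷ cs) ≡ ⨁ (picks rs) (λ q → M (proj₁ q) c ∧ detF2 M (proj₂ q) cs)
  detF2-expandColumn M []       c cs = refl
  detF2-expandColumn M (r ∷ rs) c cs = begin
    detF2 M (r ∷ rs) (c ∷ cs)
      ≡⟨ ⨁-picks-∷ c cs (λ p → M r (proj₁ p) ∧ detF2 M rs (proj₂ p)) ⟩
    (M r c ∧ detF2 M rs cs) xor ⨁ (picks cs) (λ p → M r (proj₁ p) ∧ detF2 M rs (c ∷ proj₂ p))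
      ≡⟨ cong ((M r c ∧ detF2 M rs cs) xor_) minors ⟩
    (M r c ∧ detF2 M rs cs) xor ⨁ (picks rs) (λ q → M (proj₁ q) c ∧ detF2 M (r ∷ proj₂ q) cs)
      ≡⟨ sym (⨁-picks-∷ r rs (λ q → M (proj₁ q) c ∧ detF2 M (proj₂ q) cs)) ⟩
    ⨁ (picks (r ∷ rs)) (λ q → M (proj₁ q) c ∧ detF2 M (proj₂ q) cs)
      ∎
    where
    open ≡-Reasoning
    term : Fin n × List (Fin n) → Fin n × List (Fin n) → Bool
    term p q = M r (proj₁ p) ∧ (M (proj₁ q) c ∧ detF2 M (proj₂ q) (proj₂ p))
    minors : ⨁ (picks cs) (λ p → M r (proj₁ p) ∧ detF2 M rs (c ∷ proj₂ p))
           ≡ ⨁ (picks rs) (λ q → M (proj₁ q) c ∧ detF2 M (r ∷ proj₂ q) cs)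
    minors = begin
      ⨁ (picks cs) (λ p → M r (proj₁ p) ∧ detF2 M rs (c ∷ proj₂ p))
        ≡⟨ ⨁-cong (picks cs) (λ p → ≡.trans (cong (M r (proj₁ p) ∧_) (detF2-expandColumn M rs c (proj₂ p)))
                                             (∧-distribˡ-⨁ (M r (proj₁ p)) (picks rs) _)) ⟩
      ⨁ (picks cs) (λ p → ⨁ (picks rs) (term p))
        ≡⟨ ⨁-comm (picks cs) (picks rs) term ⟩
      ⨁ (picks rs) (λ q → ⨁ (picks cs) (λ p → term p q))
        ≡⟨ ⨁-cong (picks rs) (λ q → ≡.trans
             (⨁-cong (picks cs) (λ p → ∧-left-comm (M r (proj₁ p)) (M (proj₁ q) c) _))
             (sym (∧-distribˡ-⨁ (M (proj₁ q) c) (picks cs) _))) ⟩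
      ⨁ (picks rs) (λ q → M (proj₁ q) c ∧ ⨁ (picks cs) (λ p → M r (proj₁ p) ∧ detF2 M (proj₂ q) (proj₂ p)))
        ≡⟨ ⨁-cong (picks rs) (λ q → cong (M (proj₁ q) c ∧_) (sym (detF2-∷ M r (proj₂ q) cs))) ⟩
      ⨁ (picks rs) (λ q → M (proj₁ q) c ∧ detF2 M (r ∷ proj₂ q) cs)
        ∎

  _ᵀ : Matrix n → Matrix n
  (M ᵀ) i j = M j i

  detF2-transpose : ∀ (M : Matrix n) rs cs → detF2 M rs cs ≡ detF2 (M ᵀ) cs rs
  detF2-transpose M []       []      = refl
  detF2-transpose M []       (_ ∷ _) = refl
  detF2-transpose M (_ ∷ _)  []      = refl
  detF2-transpose M (r ∷ rs) (c ∷ cs) =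
    ≡.trans (⨁-cong (picks (c ∷ cs)) (λ p → cong (M r (proj₁ p) ∧_) (detF2-transpose M rs (proj₂ p))))
            (sym (detF2-expandColumn (M ᵀ) (c ∷ cs) r rs))

  detF2-comm : ∀ (M : Matrix n) → Symmetric M → ∀ rs cs → detF2 M rs cs ≡ detF2 M cs rs
  detF2-comm M sym-M rs cs =
    ≡.trans (detF2-transpose M rs cs) (detF2-cong (M ᵀ) M (λ i j → sym-M j i) cs rs)

  detF2-swapRows : ∀ (M : Matrix n) x y rs cs → detF2 M (x ∷ y ∷ rs) cs ≡ detF2 M (y ∷ x ∷ rs) cs
  detF2-swapRows M x y rs cs = begin
    detF2 M (x ∷ y ∷ rs) cs
      ≡⟨ expandTwice x y ⟩
    ⨁ (picks cs) (λ p → ⨁ (picks (proj₂ p)) (λ q → M x (proj₁ p) ∧ (M y (proj₁ q) ∧ detF2 M rs (proj₂ q))))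
      ≡⟨ ⨁-picks²-flip (λ a b r → M x a ∧ (M y b ∧ detF2 M rs r)) cs ⟩
    ⨁ (picks cs) (λ p → ⨁ (picks (proj₂ p)) (λ q → M x (proj₁ q) ∧ (M y (proj₁ p) ∧ detF2 M rs (proj₂ q))))
      ≡⟨ ⨁-cong (picks cs) (λ p → ⨁-cong (picks (proj₂ p)) (λ q →
           ∧-left-comm (M x (proj₁ q)) (M y (proj₁ p)) _)) ⟩
    ⨁ (picks cs) (λ p → ⨁ (picks (proj₂ p)) (λ q → M y (proj₁ p) ∧ (M x (proj₁ q) ∧ detF2 M rs (proj₂ q))))
      ≡⟨ sym (expandTwice y x) ⟩
    detF2 M (y ∷ x ∷ rs) cs
      ∎
    where
    open ≡-Reasoning
    expandTwice : ∀ a b → detF2 M (a ∷ b ∷ rs) cs ≡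
      ⨁ (picks cs) (λ p → ⨁ (picks (proj₂ p)) (λ q → M a (proj₁ p) ∧ (M b (proj₁ q) ∧ detF2 M rs (proj₂ q))))
    expandTwice a b = ≡.trans (detF2-∷ M a (b ∷ rs) cs) (⨁-cong (picks cs) (λ p →
      ≡.trans (cong (M a (proj₁ p) ∧_) (detF2-∷ M b rs (proj₂ p)))
              (∧-distribˡ-⨁ (M a (proj₁ p)) (picks (proj₂ p)) _)))

  detF2-∷-cong-rows : ∀ (M : Matrix n) x {rs rs'} → (∀ cs → detF2 M rs cs ≡ detF2 M rs' cs) →
    ∀ cs → detF2 M (x ∷ rs) cs ≡ detF2 M (x ∷ rs') cs
  detF2-∷-cong-rows M x {rs} {rs'} eq cs = ≡.trans (detF2-∷ M x rs cs) (≡.trans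
    (⨁-cong (picks cs) (λ p → cong (M x (proj₁ p) ∧_) (eq (proj₂ p)))) (sym (detF2-∷ M x rs' cs)))

  detF2-↭-rows : ∀ (M : Matrix n) {rs rs'} → rs ↭ rs' → ∀ cs → detF2 M rs cs ≡ detF2 M rs' cs
  detF2-↭-rows M refl          cs = refl
  detF2-↭-rows M (prep x π)    cs = detF2-∷-cong-rows M x (detF2-↭-rows M π) cs
  detF2-↭-rows M (swap x y π)  cs = ≡.trans
    (detF2-∷-cong-rows M x (detF2-∷-cong-rows M y (detF2-↭-rows M π)) cs) (detF2-swapRows M x y _ cs)
  detF2-↭-rows M (trans π π') cs = ≡.trans (detF2-↭-rows M π cs) (detF2-↭-rows M π' cs)

  detF2-principal-↭ : ∀ (M : Matrix n) → Symmetric M → ∀ {L L'} → L ↭ L' → detF2 M L L ≡ detF2 M L' L'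
  detF2-principal-↭ M sym-M {L} {L'} π = begin
    detF2 M L L     ≡⟨ detF2-↭-rows M π L ⟩
    detF2 M L' L    ≡⟨ detF2-comm M sym-M L' L ⟩
    detF2 M L L'    ≡⟨ detF2-↭-rows M π L' ⟩
    detF2 M L' L'   ∎
    where open ≡-Reasoning

picks-map : ∀ {A B : Set} (f : A → B) (cs : List A) →
  picks (map f cs) ≡ map (λ p → f (proj₁ p) , map f (proj₂ p)) (picks cs)
picks-map f []       = refl
picks-map f (c ∷ cs) = cong ((f c , map f cs) ∷_)
  (≡.trans (cong (map _) (picks-map f cs)) (≡.trans (sym (map-∘ (picks cs))) (map-∘ (picks cs))))

⨁-picks-map : ∀ {A B : Set} (f : A → B) cs (g : B × List B → Bool) →
  ⨁ (picks (map f cs)) g ≡ ⨁ (picks cs) (λ p → g (f (proj₁ p) , map f (proj₂ p)))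
⨁-picks-map f cs g = ≡.trans (cong (λ ps → ⨁ ps g) (picks-map f cs)) (⨁-map (picks cs) _ g)

detF2-map : ∀ {m n} (M : Matrix n) (f : Fin m → Fin n) rs cs →
  detF2 M (map f rs) (map f cs) ≡ detF2 (λ i j → M (f i) (f j)) rs cs
detF2-map M f []       []       = refl
detF2-map M f []       (_ ∷ _)  = refl
detF2-map M f (_ ∷ _)  []       = refl
detF2-map M f (r ∷ rs) (c ∷ cs) = ≡.trans
  (⨁-picks-map f (c ∷ cs) (λ p → M (f r) (proj₁ p) ∧ detF2 M (map f rs) (proj₂ p)))
  (⨁-cong (picks (c ∷ cs)) (λ p → cong (M (f r) (f (proj₁ p)) ∧_) (detF2-map M f rs (proj₂ p))))

picks-length : ∀ {A : Set} (xs : List A) → All (λ p → suc (length (proj₂ p)) ≡ length xs) (picks xs)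
picks-length []       = []
picks-length (x ∷ xs) = refl ∷ map⁺ (All.map (cong suc) (picks-length xs))

module _ {n : ℕ} (M : Matrix n) (sym-M : Symmetric M) where

  detF2-principal-∷ : ∀ r R → detF2 M (r ∷ R) (r ∷ R) ≡
    (M r r ∧ detF2 M R R) xor ⨁ (picks R) (λ p → M r (proj₁ p) ∧ detF2 M R (r ∷ proj₂ p))
  detF2-principal-∷ r R = ⨁-picks-∷ r R (λ p → M r (proj₁ p) ∧ detF2 M R (proj₂ p))

  -- Expanding also along column r gives a symmetric double sum, of which only the diagonal survives.
  detF2-principal-expand : ∀ r → M r r ≡ false → ∀ R →
    detF2 M (r ∷ R) (r ∷ R) ≡ ⨁ (picks R) (λ p → M r (proj₁ p) ∧ detF2 M (proj₂ p) (proj₂ p))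
  detF2-principal-expand r Mrr≡false R = begin
    detF2 M (r ∷ R) (r ∷ R)
      ≡⟨ detF2-principal-∷ r R ⟩
    (M r r ∧ detF2 M R R) xor offDiagonal
      ≡⟨ cong (λ b → (b ∧ detF2 M R R) xor offDiagonal) Mrr≡false ⟩
    offDiagonal
      ≡⟨ ⨁-cong (picks R) (λ p → ≡.trans (cong (M r (proj₁ p) ∧_) (detF2-expandColumn M R r (proj₂ p)))
           (≡.trans (∧-distribˡ-⨁ (M r (proj₁ p)) (picks R) (λ q → M (proj₁ q) r ∧ detF2 M (proj₂ q) (proj₂ p)))
             (⨁-cong (picks R) (λ q → cong (λ b → M r (proj₁ p) ∧ (b ∧ detF2 M (proj₂ q) (proj₂ p)))
                                            (sym-M (proj₁ q) r))))) ⟩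
    ⨁ (picks R) (λ p → ⨁ (picks R) (term p))
      ≡⟨ ⨁-diagonal (picks R) term term-sym ⟩
    ⨁ (picks R) (λ p → term p p)
      ≡⟨ ⨁-cong (picks R) (λ p → ≡.trans (sym (∧-assoc (M r (proj₁ p)) (M r (proj₁ p)) _))
                                         (cong (_∧ detF2 M (proj₂ p) (proj₂ p)) (∧-idem (M r (proj₁ p))))) ⟩
    ⨁ (picks R) (λ p → M r (proj₁ p) ∧ detF2 M (proj₂ p) (proj₂ p))
      ∎
    where
    open ≡-Reasoning
    offDiagonal = ⨁ (picks R) (λ p → M r (proj₁ p) ∧ detF2 M R (r ∷ proj₂ p))
    term : Fin n × List (Fin n) → Fin n × List (Fin n) → Bool
    term p q = M r (proj₁ p) ∧ (M r (proj₁ q) ∧ detF2 M (proj₂ q) (proj₂ p))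
    term-sym : ∀ p q → term p q ≡ term q p
    term-sym p q = ≡.trans (∧-left-comm (M r (proj₁ p)) (M r (proj₁ q)) _)
      (cong (λ d → M r (proj₁ q) ∧ (M r (proj₁ p) ∧ d)) (detF2-comm M sym-M (proj₂ q) (proj₂ p)))

  detF2-odd : (∀ i → M i i ≡ false) → ∀ k L → length L ≡ k → parity k ≡ 1ℙ → detF2 M L L ≡ false
  detF2-odd zero-diag (suc zero)    (r ∷ [])    refl odd = detF2-principal-expand r (zero-diag r) []
  detF2-odd zero-diag (suc (suc k)) (r ∷ R)     len  odd = ≡.trans (detF2-principal-expand r (zero-diag r) R)
    (≡.trans (⨁-cong-local {g = λ _ → false} (All.map (λ {p} → minor-vanishes {p}) (picks-length R))) (⨁-false (picks R)))
    where
    minor-vanishes : ∀ {p : Fin n × List (Fin n)} → suc (length (proj₂ p)) ≡ length R →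
                     M r (proj₁ p) ∧ detF2 M (proj₂ p) (proj₂ p) ≡ false
    minor-vanishes {c , R'} len' = ≡.trans
      (cong (M r c ∧_) (detF2-odd zero-diag k R' (suc-injective (≡.trans len' (suc-injective len))) odd))
      (∧-zeroʳ (M r c))

map-suc-punchIn : ∀ {n} (v : Fin (suc n)) E → map suc (map (punchIn v) E) ≡ map (punchIn (suc v)) (map suc E)
map-suc-punchIn v E = ≡.trans (sym (map-∘ E)) (map-∘ E)

elems-insertAt-false : ∀ {n} (Y : Subset n) v → elems (insertAt Y v false) ≡ map (punchIn v) (elems Y)
elems-insertAt-false Y           zero    = map-cong (λ _ → refl) (elems Y)
elems-insertAt-false (true ∷ Y)  (suc v) =
  cong (zero ∷_) (≡.trans (cong (map suc) (elems-insertAt-false Y v)) (map-suc-punchIn v (elems Y)))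
elems-insertAt-false (false ∷ Y) (suc v) =
  ≡.trans (cong (map suc) (elems-insertAt-false Y v)) (map-suc-punchIn v (elems Y))

elems-insertAt-true : ∀ {n} (Y : Subset n) v → elems (insertAt Y v true) ↭ v ∷ map (punchIn v) (elems Y)
elems-insertAt-true Y           zero    = prep zero (↭-reflexive (map-cong (λ _ → refl) (elems Y)))
elems-insertAt-true (true ∷ Y)  (suc v) = trans (prep zero (trans (↭-map⁺ suc (elems-insertAt-true Y v))
  (↭-reflexive (cong (suc v ∷_) (map-suc-punchIn v (elems Y)))))) (swap zero (suc v) refl)
elems-insertAt-true (false ∷ Y) (suc v) = trans (↭-map⁺ suc (elems-insertAt-true Y v))
  (↭-reflexive (cong (suc v ∷_) (map-suc-punchIn v (elems Y))))

length-elems : ∀ {n} (Y : Subset n) → length (elems Y) ≡ card Y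
length-elems []          = refl
length-elems (true ∷ Y)  = cong suc (≡.trans (length-map suc (elems Y)) (length-elems Y))
length-elems (false ∷ Y) = ≡.trans (length-map suc (elems Y)) (length-elems Y)

elems-empty : ∀ n → elems (replicate n false) ≡ []
elems-empty zero    = refl
elems-empty (suc n) = cong (map suc) (elems-empty n)

picks-elems : ∀ {n} (Y : Subset n) → All (λ p → proj₂ p ≡ elems (Y [ proj₁ p ]≔ false)) (picks (elems Y))
picks-elems []          = []
picks-elems (true ∷ Y)  = refl ∷ ≡.subst (All _)
  (≡.trans (map-∘ (picks (elems Y))) (sym (cong (map _) (picks-map suc (elems Y)))))
  (map⁺ (All.map (cong (λ R → zero ∷ map suc R)) (picks-elems Y)))
picks-elems (false ∷ Y) = ≡.subst (All _) (sym (picks-map suc (elems Y)))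
  (map⁺ (All.map (cong (map suc)) (picks-elems Y)))

card-insertAt : ∀ {n} (Y : Subset n) v b → card (insertAt Y v b) ≡ card (b ∷ Y)
card-insertAt Y           zero    b     = refl
card-insertAt (true ∷ Y)  (suc v) true  = cong suc (card-insertAt Y v true)
card-insertAt (true ∷ Y)  (suc v) false = cong suc (card-insertAt Y v false)
card-insertAt (false ∷ Y) (suc v) true  = card-insertAt Y v true
card-insertAt (false ∷ Y) (suc v) false = card-insertAt Y v false

insertAt-△ : ∀ {n} (Y A : Subset n) v b b' → insertAt Y v b △ insertAt A v b' ≡ insertAt (Y △ A) v (b xor b')
insertAt-△ Y       A       zero    b b' = refl
insertAt-△ (y ∷ Y) (a ∷ A) (suc v) b b' = cong ((y xor a) ∷_) (insertAt-△ Y A v b b')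

△-involutive : ∀ {n} (X A : Subset n) → (X △ A) △ A ≡ X
△-involutive []      []      = refl
△-involutive (x ∷ X) (a ∷ A) = cong₂ _∷_
  (≡.trans (xor-assoc x a a) (≡.trans (cong (x xor_) (xor-same a)) (xor-identityʳ x))) (△-involutive X A)

△-∁ : ∀ {n} (X A : Subset n) → X △ ∁ A ≡ ∁ (X △ A)
△-∁ []      []      = refl
△-∁ (x ∷ X) (a ∷ A) = cong₂ _∷_ (sym (not-distribʳ-xor x a)) (△-∁ X A)

card-∁ : ∀ {n} (X : Subset n) → card X + card (∁ X) ≡ n
card-∁ []          = refl
card-∁ (true ∷ X)  = cong suc (card-∁ X)
card-∁ (false ∷ X) = ≡.trans (+-suc (card X) _) (cong suc (card-∁ X))

card-∷-≤ : ∀ {n} x y (X : Subset n) → card (x ∷ X) ≤ suc (card (y ∷ X))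
card-∷-≤ true  true  X = n≤1+n _
card-∷-≤ true  false X = ≤-refl
card-∷-≤ false true  X = ≤-trans (n≤1+n _) (n≤1+n _)
card-∷-≤ false false X = n≤1+n _

card-∷-mono : ∀ {n} x (X X' : Subset n) → card X ≤ suc (card X') → card (x ∷ X) ≤ suc (card (x ∷ X'))
card-∷-mono true  X X' = s≤s
card-∷-mono false X X' = id

card-≤-[]≔ : ∀ {n} (X : Subset n) c b → card X ≤ suc (card (X [ c ]≔ b))
card-≤-[]≔ (x ∷ X) zero    b = card-∷-≤ x b X
card-≤-[]≔ (x ∷ X) (suc c) b = card-∷-mono x X _ (card-≤-[]≔ X c b)

card-[]≔-≤ : ∀ {n} (X : Subset n) c b → card (X [ c ]≔ b) ≤ suc (card X)
card-[]≔-≤ (x ∷ X) zero    b = card-∷-≤ b x X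
card-[]≔-≤ (x ∷ X) (suc c) b = card-∷-mono x _ X (card-[]≔-≤ X c b)

[]≔-△ : ∀ {n} (Y A : Subset n) c b → (Y [ c ]≔ b) △ A ≡ (Y △ A) [ c ]≔ (b xor lookup A c)
[]≔-△ (y ∷ Y) (a ∷ A) zero    b = refl
[]≔-△ (y ∷ Y) (a ∷ A) (suc c) b = cong ((y xor a) ∷_) ([]≔-△ Y A c b)

parity-suc : ∀ k → parity (suc k) ≡ parity k ⁻¹
parity-suc k = sym (⁻¹-selfInverse (suc-homo-⁻¹ k))

parity-card-△ : ∀ {n} (X A : Subset n) → parity (card (X △ A)) ≡ parity (card X) ℙ.+ parity (card A)
parity-card-△ []          []          = refl
parity-card-△ (true ∷ X)  (true ∷ A)  = ≡.trans (parity-card-△ X A)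
  (≡.trans (sym (⁻¹+⁻¹ (parity (card X)) _)) (cong₂ ℙ._+_ (sym (parity-suc (card X))) (sym (parity-suc (card A)))))
  where
  ⁻¹+⁻¹ : ∀ p q → p ⁻¹ ℙ.+ q ⁻¹ ≡ p ℙ.+ q
  ⁻¹+⁻¹ 0ℙ q = ⁻¹-involutive q
  ⁻¹+⁻¹ 1ℙ q = refl
parity-card-△ (true ∷ X)  (false ∷ A) = ≡.trans (parity-suc (card (X △ A))) (≡.trans (cong _⁻¹ (parity-card-△ X A))
  (≡.trans (sym (⁻¹+ (parity (card X)) (parity (card A)))) (cong (ℙ._+ parity (card A)) (sym (parity-suc (card X))))))
  where
  ⁻¹+ : ∀ p q → p ⁻¹ ℙ.+ q ≡ (p ℙ.+ q) ⁻¹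
  ⁻¹+ 0ℙ q = refl
  ⁻¹+ 1ℙ q = sym (⁻¹-involutive q)
parity-card-△ (false ∷ X) (true ∷ A)  = ≡.trans (parity-suc (card (X △ A))) (≡.trans (cong _⁻¹ (parity-card-△ X A))
  (≡.trans (sym (+⁻¹ (parity (card X)) (parity (card A)))) (cong (parity (card X) ℙ.+_) (sym (parity-suc (card A))))))
  where
  +⁻¹ : ∀ p q → p ℙ.+ q ⁻¹ ≡ (p ℙ.+ q) ⁻¹
  +⁻¹ 0ℙ q = refl
  +⁻¹ 1ℙ q = refl
parity-card-△ (false ∷ X) (false ∷ A) = parity-card-△ X A

maxL-upper : ∀ xs → All (_≤ maxL xs) xs
maxL-upper []       = []
maxL-upper (x ∷ xs) = m≤m⊔n x (maxL xs) ∷ All.map (λ le → ≤-trans le (m≤n⊔m x (maxL xs))) (maxL-upper xs)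

maxL-least : ∀ {h} xs → All (_≤ h) xs → maxL xs ≤ h
maxL-least []       []         = z≤n
maxL-least (x ∷ xs) (x≤h ∷ xs≤h) = ⊔-lub x≤h (maxL-least xs xs≤h)

maxL-∈ : ∀ {k} xs → k ∈ xs → maxL xs ∈ xs
maxL-∈ (x ∷ xs) _ with ⊔-sel x (maxL xs)
... | inj₁ max≡x = here max≡x
maxL-∈ (x ∷ [])     _ | inj₂ max≡0   = here (⊔-identityʳ x)
maxL-∈ (x ∷ y ∷ xs) _ | inj₂ max≡max = there (≡.subst (_∈ y ∷ xs) (sym max≡max) (maxL-∈ (y ∷ xs) (here refl)))

minL-lower : ∀ xs → All (minL xs ≤_) xs
minL-lower []       = []
minL-lower (x ∷ xs) = go x xs
  where
  go : ∀ x xs → All (foldr _⊓_ x xs ≤_) (x ∷ xs)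
  go x []       = ≤-refl ∷ []
  go x (y ∷ xs) with go x xs
  ... | x≥ ∷ xs≥ = ≤-trans (m⊓n≤n y _) x≥ ∷ m⊓n≤m y _ ∷ All.map (≤-trans (m⊓n≤n y _)) xs≥

minL-∈ : ∀ {k} xs → k ∈ xs → minL xs ∈ xs
minL-∈ (x ∷ xs) _ = go x xs
  where
  go : ∀ x xs → foldr _⊓_ x xs ∈ x ∷ xs
  go x []       = here refl
  go x (y ∷ xs) with ⊓-sel y (foldr _⊓_ x xs) | go x xs
  ... | inj₁ min≡y | _          = there (here min≡y)
  ... | inj₂ min≡m | here m≡x   = here (≡.trans min≡m m≡x)
  ... | inj₂ min≡m | there m∈xs = there (there (≡.subst (_∈ xs) (sym min≡m) m∈xs))

maxL-≡ : ∀ {h} xs → All (_≤ h) xs → h ∈ xs → maxL xs ≡ h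
maxL-≡ xs xs≤h h∈xs = ≤-antisym (maxL-least xs xs≤h) (All.lookup (maxL-upper xs) h∈xs)

minL-≡ : ∀ {l} xs → All (l ≤_) xs → l ∈ xs → minL xs ≡ l
minL-≡ xs l≤xs l∈xs = ≤-antisym (All.lookup (minL-lower xs) l∈xs) (All.lookup l≤xs (minL-∈ xs l∈xs))

∈-allSubsets : ∀ {m} (X : Subset m) → X ∈ allSubsets m
∈-allSubsets []          = here refl
∈-allSubsets (true ∷ X)  = ∈-++⁺ˡ (∈-map⁺ (true ∷_) (∈-allSubsets X))
∈-allSubsets (false ∷ X) = ∈-++⁺ʳ (map (true ∷_) (allSubsets _)) (∈-map⁺ (false ∷_) (∈-allSubsets X))

module _ {A : Set} (p : A → Bool) where

  filterB-∈⁺ : ∀ {x xs} → x ∈ xs → p x ≡ true → x ∈ filterB p xs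
  filterB-∈⁺ {x} {y ∷ xs} x∈ px with p y in py | x∈
  ... | true  | here refl  = here refl
  ... | true  | there x∈' = there (filterB-∈⁺ x∈' px)
  ... | false | here refl  = contradiction (≡.trans (sym py) px) λ ()
  ... | false | there x∈' = filterB-∈⁺ x∈' px

  filterB-∈⁻ : ∀ {x} xs → x ∈ filterB p xs → p x ≡ true
  filterB-∈⁻ (y ∷ xs) x∈ with p y in py | x∈
  ... | true  | here refl  = py
  ... | true  | there x∈' = filterB-∈⁻ xs x∈'
  ... | false | x∈'        = filterB-∈⁻ xs x∈'

  filterB-all : ∀ {P : A → Set} → (∀ x → p x ≡ true → P x) → ∀ xs → All P (filterB p xs)
  filterB-all f []       = []
  filterB-all f (y ∷ xs) with p y in py
  ... | true  = f y py ∷ filterB-all f xs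
  ... | false = filterB-all f xs

  filterB-cong : ∀ {q : A → Bool} → (∀ x → p x ≡ q x) → ∀ xs → filterB p xs ≡ filterB q xs
  filterB-cong p≗q []       = refl
  filterB-cong p≗q (y ∷ xs) rewrite p≗q y | filterB-cong p≗q xs = refl

module _ {m : ℕ} (F : SetSystem m) (A : Subset m) where

  distances : List ℕ
  distances = map card (feasibles (F *tw A))

  Attains : ℕ → Set
  Attains k = ∃[ S ] F S ≡ true × card (S △ A) ≡ k

  UpperBound : ℕ → Set
  UpperBound h = ∀ S → F S ≡ true → card (S △ A) ≤ h

  LowerBound : ℕ → Set
  LowerBound l = ∀ S → F S ≡ true → l ≤ card (S △ A)

  IsMaxDistance : ℕ → Set
  IsMaxDistance h = Attains h × UpperBound h

  IsMinDistance : ℕ → Set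
  IsMinDistance l = Attains l × LowerBound l

  ∈-distances⁺ : ∀ {k} → Attains k → k ∈ distances
  ∈-distances⁺ (S , FS , refl) = ∈-map⁺ card (filterB-∈⁺ (F *tw A) (∈-allSubsets (S △ A))
    (≡.subst (λ X → F X ≡ true) (sym (△-involutive S A)) FS))

  ∈-distances⁻ : ∀ {k} → k ∈ distances → Attains k
  ∈-distances⁻ k∈ with ∈-map⁻ card k∈
  ... | X , X∈ , refl = X △ A , filterB-∈⁻ (F *tw A) (allSubsets m) X∈ , cong card (△-involutive X A)

  all-distances : ∀ {P : ℕ → Set} → (∀ S → F S ≡ true → P (card (S △ A))) → All P distances
  all-distances {P} f = map⁺ (filterB-all (F *tw A)
    (λ X FX → ≡.subst P (cong card (△-involutive X A)) (f (X △ A) FX)) (allSubsets m))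

  width-twist : ∀ {l h} → IsMinDistance l → IsMaxDistance h → width (F *tw A) ≡ h ∸ l
  width-twist (attains-l , l≤) (attains-h , ≤h) = cong₂ _∸_
    (maxL-≡ distances (all-distances ≤h) (∈-distances⁺ attains-h))
    (minL-≡ distances (all-distances l≤) (∈-distances⁺ attains-l))

  maxDistance : ∀ {k} → Attains k → ∃[ h ] IsMaxDistance h
  maxDistance att = maxL distances , ∈-distances⁻ (maxL-∈ distances (∈-distances⁺ att))
    , λ S FS → All.lookup (maxL-upper distances) (∈-distances⁺ (S , FS , refl))

  minDistance : ∀ {k} → Attains k → ∃[ l ] IsMinDistance l
  minDistance att = minL distances , ∈-distances⁻ (minL-∈ distances (∈-distances⁺ att))
    , λ S FS → All.lookup (minL-lower distances) (∈-distances⁺ (S , FS , refl))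

width-cong : ∀ {m} {F F' : SetSystem m} → (∀ X → F X ≡ F' X) → ∀ A → width (F *tw A) ≡ width (F' *tw A)
width-cong {m} F≗F' A = cong (λ Xs → maxL (map card Xs) ∸ minL (map card Xs))
  (filterB-cong _ (λ X → F≗F' (X △ A)) (allSubsets m))

+-≡⇒∸-swap : ∀ {a b a' b'} → a + b ≡ a' + b' → b ∸ b' ≡ a' ∸ a
+-≡⇒∸-swap {a} {b} {a'} {b'} eq = begin
  b ∸ b'               ≡⟨ sym ([m+n]∸[m+o]≡n∸o a b b') ⟩
  (a + b) ∸ (a + b')   ≡⟨ cong₂ _∸_ (≡.trans eq (+-comm a' b')) (+-comm a b') ⟩
  (b' + a') ∸ (b' + a) ≡⟨ [m+n]∸[m+o]≡n∸o b' a' a ⟩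
  a' ∸ a               ∎
  where open ≡-Reasoning

+-≡⇒≤-antitone : ∀ {a b a' b'} → a + b ≡ a' + b' → a ≤ a' → b' ≤ b
+-≡⇒≤-antitone {a} {b} {a'} {b'} eq a≤a' =
  +-cancelˡ-≤ a b' b (≡.subst (a + b' ≤_) (sym eq) (+-monoˡ-≤ b' a≤a'))

card-△-∁ : ∀ {m} (S A : Subset m) → card (S △ A) + card (S △ ∁ A) ≡ m
card-△-∁ S A = ≡.trans (cong (card (S △ A) +_) (cong card (△-∁ S A))) (card-∁ (S △ A))

-- Complementing the twist turns every distance k into m - k, which reverses max and min.
width-∁ : ∀ {m} (F : SetSystem m) A {k} → Attains F A k → width (F *tw ∁ A) ≡ width (F *tw A)
width-∁ F A att with minDistance F A att | maxDistance F A att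
... | l , min@((Sl , FSl , refl) , l≤) | h , max@((Sh , FSh , refl) , ≤h) = begin
  width (F *tw ∁ A)                     ≡⟨ width-twist F (∁ A) ((Sh , FSh , refl) , lower) ((Sl , FSl , refl) , upper) ⟩
  card (Sl △ ∁ A) ∸ card (Sh △ ∁ A)     ≡⟨ +-≡⇒∸-swap {a = card (Sl △ A)} {a' = card (Sh △ A)}
                                             (≡.trans (card-△-∁ Sl A) (sym (card-△-∁ Sh A))) ⟩
  card (Sh △ A) ∸ card (Sl △ A)         ≡⟨ sym (width-twist F A min max) ⟩
  width (F *tw A)                       ∎
  where
  open ≡-Reasoning
  lower : LowerBound F (∁ A) (card (Sh △ ∁ A))
  lower S FS = +-≡⇒≤-antitone (≡.trans (card-△-∁ S A) (sym (card-△-∁ Sh A))) (≤h S FS)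
  upper : UpperBound F (∁ A) (card (Sl △ ∁ A))
  upper S FS = +-≡⇒≤-antitone (≡.trans (card-△-∁ Sl A) (sym (card-△-∁ S A))) (l≤ S FS)

h≤x≤2+h⇒x≢1+h⇒x≡h∨x≡2+h : ∀ {h x} → h ≤ x → x ≤ 2 + h → x ≢ 1 + h → x ≡ h ⊎ x ≡ 2 + h
h≤x≤2+h⇒x≢1+h⇒x≡h∨x≡2+h h≤x x≤2+h x≢1+h with m≤n⇒m<n∨m≡n h≤x
... | inj₂ h≡x = inj₁ (sym h≡x)
... | inj₁ h<x with m≤n⇒m<n∨m≡n h<x
...   | inj₂ 1+h≡x = contradiction (sym 1+h≡x) x≢1+h
...   | inj₁ 1+h<x = inj₂ (≤-antisym x≤2+h 1+h<x)

twist-identity-shift : ∀ z w → (z + 1) * z ^ suc w ≡ z * z ^ w + z ^ 2 * z ^ w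
twist-identity-shift z w = lemma z (z ^ w)
  where
  lemma : ∀ z x → (z + 1) * (z * x) ≡ z * x + z * (z * 1) * x
  lemma = solve-∀

twist-identity-jump : ∀ z w → (z + 1) * z ^ (2 + w) ≡ z * z ^ (2 + w) + z ^ 2 * z ^ w
twist-identity-jump z w = lemma z (z ^ w)
  where
  lemma : ∀ z x → (z + 1) * (z * (z * x)) ≡ z * (z * (z * x)) + z * (z * 1) * x
  lemma = solve-∀

module _ {A : Set} where

  sum-map-+ : ∀ (f g : A → ℕ) xs → sum (map (λ x → f x + g x) xs) ≡ sum (map f xs) + sum (map g xs)
  sum-map-+ f g []       = refl
  sum-map-+ f g (x ∷ xs) = ≡.trans (cong (f x + g x +_) (sum-map-+ f g xs))
    (+-interchange (f x) (g x) (sum (map f xs)) (sum (map g xs)))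

  *-distribˡ-sum-map : ∀ c (f : A → ℕ) xs → c * sum (map f xs) ≡ sum (map (λ x → c * f x) xs)
  *-distribˡ-sum-map c f []       = *-zeroʳ c
  *-distribˡ-sum-map c f (x ∷ xs) = ≡.trans (*-distribˡ-+ c (f x) _) (cong (c * f x +_) (*-distribˡ-sum-map c f xs))

∑ₛ : ∀ {n} → (Subset n → ℕ) → ℕ
∑ₛ {n} f = sum (map f (allSubsets n))

∑ₛ-cong : ∀ {n} {f g : Subset n → ℕ} → (∀ X → f X ≡ g X) → ∑ₛ f ≡ ∑ₛ g
∑ₛ-cong {n} f≗g = cong sum (map-cong f≗g (allSubsets n))

∑ₛ-+ : ∀ {n} (f g : Subset n → ℕ) → ∑ₛ (λ X → f X + g X) ≡ ∑ₛ f + ∑ₛ g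
∑ₛ-+ {n} f g = sum-map-+ f g (allSubsets n)

*-distribˡ-∑ₛ : ∀ {n} c (f : Subset n → ℕ) → c * ∑ₛ f ≡ ∑ₛ (λ X → c * f X)
*-distribˡ-∑ₛ {n} c f = *-distribˡ-sum-map c f (allSubsets n)

∑ₛ-∷ : ∀ {n} (f : Subset (suc n) → ℕ) → ∑ₛ f ≡ ∑ₛ (λ Y → f (true ∷ Y)) + ∑ₛ (λ Y → f (false ∷ Y))
∑ₛ-∷ {n} f = begin
  sum (map f (map (true ∷_) (allSubsets n) ++ map (false ∷_) (allSubsets n)))
    ≡⟨ cong sum (map-++ f (map (true ∷_) (allSubsets n)) _) ⟩
  sum (map f (map (true ∷_) (allSubsets n)) ++ map f (map (false ∷_) (allSubsets n)))
    ≡⟨ sum-++ (map f (map (true ∷_) (allSubsets n))) (map f (map (false ∷_) (allSubsets n))) ⟩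
  sum (map f (map (true ∷_) (allSubsets n))) + sum (map f (map (false ∷_) (allSubsets n)))
    ≡⟨ cong₂ _+_ (cong sum (sym (map-∘ (allSubsets n)))) (cong sum (sym (map-∘ (allSubsets n)))) ⟩
  ∑ₛ (λ Y → f (true ∷ Y)) + ∑ₛ (λ Y → f (false ∷ Y))
    ∎
  where open ≡-Reasoning

∑ₛ-insertAt : ∀ {n} (v : Fin (suc n)) (f : Subset (suc n) → ℕ) →
  ∑ₛ f ≡ ∑ₛ (λ Y → f (insertAt Y v true) + f (insertAt Y v false))
∑ₛ-insertAt         zero    f = ≡.trans (∑ₛ-∷ f) (sym (∑ₛ-+ (λ Y → f (true ∷ Y)) (λ Y → f (false ∷ Y))))
∑ₛ-insertAt {suc n} (suc v) f = begin
  ∑ₛ f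
    ≡⟨ ∑ₛ-∷ f ⟩
  ∑ₛ (λ Y → f (true ∷ Y)) + ∑ₛ (λ Y → f (false ∷ Y))
    ≡⟨ cong₂ _+_ (∑ₛ-insertAt v (λ Y → f (true ∷ Y))) (∑ₛ-insertAt v (λ Y → f (false ∷ Y))) ⟩
  ∑ₛ (λ Y → split (true ∷ Y)) + ∑ₛ (λ Y → split (false ∷ Y))
    ≡⟨ sym (∑ₛ-∷ split) ⟩
  ∑ₛ split
    ∎
  where
  open ≡-Reasoning
  split : Subset (suc n) → ℕ
  split Y = f (insertAt Y (suc v) true) + f (insertAt Y (suc v) false)

∑ₛ-removeAt : ∀ {n} (v : Fin (suc n)) (g : Subset n → ℕ) → ∑ₛ (λ A → g (removeAt A v)) ≡ 2 * ∑ₛ g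
∑ₛ-removeAt v g = begin
  ∑ₛ (λ A → g (removeAt A v))
    ≡⟨ ∑ₛ-insertAt v (λ A → g (removeAt A v)) ⟩
  ∑ₛ (λ Y → g (removeAt (insertAt Y v true) v) + g (removeAt (insertAt Y v false) v))
    ≡⟨ ∑ₛ-cong (λ Y → cong₂ _+_ (cong g (removeAt-insertAt Y v true)) (cong g (removeAt-insertAt Y v false))) ⟩
  ∑ₛ (λ Y → g Y + g Y)
    ≡⟨ ∑ₛ-+ g g ⟩
  ∑ₛ g + ∑ₛ g
    ≡⟨ cong (∑ₛ g +_) (sym (+-identityʳ (∑ₛ g))) ⟩
  2 * ∑ₛ g
    ∎
  where open ≡-Reasoning

twistPoly-cong : ∀ {m} {F F' : SetSystem m} → (∀ X → F X ≡ F' X) → ∀ z → twistPoly F z ≡ twistPoly F' z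
twistPoly-cong F≗F' z = ∑ₛ-cong (λ A → cong (z ^_) (width-cong F≗F' A))

extendAt : ∀ {n} → Fin (suc n) → SetSystem n → SetSystem n → SetSystem (suc n)
extendAt v E₀ E₁ X = if lookup X v then E₁ (removeAt X v) else E₀ (removeAt X v)

module _ {n} (v : Fin (suc n)) (E₀ E₁ : SetSystem n) where

  extendAt-insertAt : ∀ Y b → extendAt v E₀ E₁ (insertAt Y v b) ≡ (if b then E₁ Y else E₀ Y)
  extendAt-insertAt Y b rewrite insertAt-lookup Y v b | removeAt-insertAt Y v b = refl

  extendAt-unique : ∀ (F : SetSystem (suc n)) → (∀ Y b → F (insertAt Y v b) ≡ (if b then E₁ Y else E₀ Y)) →
    ∀ X → F X ≡ extendAt v E₀ E₁ X
  extendAt-unique F agree X = ≡.subst (λ X → F X ≡ extendAt v E₀ E₁ X) (insertAt-removeAt X v)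
    (≡.trans (agree (removeAt X v) (lookup X v)) (sym (extendAt-insertAt (removeAt X v) (lookup X v))))

  extendAt-cases : ∀ X → extendAt v E₀ E₁ X ≡ true →
    (∃[ Y ] X ≡ insertAt Y v false × E₀ Y ≡ true) ⊎ (∃[ Y ] X ≡ insertAt Y v true × E₁ Y ≡ true)
  extendAt-cases X feasible with lookup X v in Xᵥ
  ... | false = inj₁ (removeAt X v , ≡.trans (sym (insertAt-removeAt X v)) (cong (insertAt _ v) Xᵥ) , feasible)
  ... | true  = inj₂ (removeAt X v , ≡.trans (sym (insertAt-removeAt X v)) (cong (insertAt _ v) Xᵥ) , feasible)

-- F₀ plays D(G − v) and P the sets S with S + v feasible in D(G); then G₀ and G₁ are D(G) and D(G + v).
module OnePointExtension {n} (v : Fin (suc n)) (F₀ P : SetSystem n)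
  (F₀-∅ : F₀ (replicate n false) ≡ true)
  (F₀-even : ∀ Y → F₀ Y ≡ true → parity (card Y) ≡ 0ℙ)
  (P-near : ∀ Y → P Y ≡ true → ∃[ c ] card Y ≡ suc (card (Y [ c ]≔ false)) × F₀ (Y [ c ]≔ false) ≡ true)
  where

  P⁺ : SetSystem n
  P⁺ Y = F₀ Y xor P Y

  G₀ G₁ : SetSystem (suc n)
  G₀ = extendAt v F₀ P
  G₁ = extendAt v F₀ P⁺

  P-odd : ∀ Y → P Y ≡ true → parity (card Y) ≡ 1ℙ
  P-odd Y PY with P-near Y PY
  ... | c , |Y|≡1+|Y'| , F₀Y' =
    ≡.trans (cong parity |Y|≡1+|Y'|) (≡.trans (parity-suc (card (Y [ c ]≔ false))) (cong _⁻¹ (F₀-even _ F₀Y')))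

  F₀⇒¬P : ∀ Y → F₀ Y ≡ true → P Y ≡ false
  F₀⇒¬P Y F₀Y with P Y in PY
  ... | false = refl
  ... | true  = contradiction (≡.trans (sym (F₀-even Y F₀Y)) (P-odd Y PY)) λ ()

  G₀⇒G₁ : ∀ X → G₀ X ≡ true → G₁ X ≡ true
  G₀⇒G₁ X G₀X with extendAt-cases v F₀ P X G₀X
  ... | inj₁ (Y , refl , F₀Y) = ≡.trans (extendAt-insertAt v F₀ P⁺ Y false) F₀Y
  ... | inj₂ (Y , refl , PY)  = ≡.trans (extendAt-insertAt v F₀ P⁺ Y true)
    (cong₂ _xor_ F₀Y-false PY)
    where
    F₀Y-false : F₀ Y ≡ false
    F₀Y-false with F₀ Y in F₀Y
    ... | false = refl
    ... | true  = contradiction (≡.trans (sym (F₀⇒¬P Y F₀Y)) PY) λ ()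

  G₁-lift : ∀ Y → F₀ Y ≡ true → G₁ (insertAt Y v true) ≡ true
  G₁-lift Y F₀Y = ≡.trans (extendAt-insertAt v F₀ P⁺ Y true) (cong₂ _xor_ F₀Y (F₀⇒¬P Y F₀Y))

  G₁-cases : ∀ X → G₁ X ≡ true → G₀ X ≡ true ⊎ (∃[ Y ] X ≡ insertAt Y v true × F₀ Y ≡ true)
  G₁-cases X G₁X with extendAt-cases v F₀ P⁺ X G₁X
  ... | inj₁ (Y , refl , F₀Y) = inj₁ (≡.trans (extendAt-insertAt v F₀ P Y false) F₀Y)
  ... | inj₂ (Y , refl , F₀⊕PY) with F₀ Y in F₀Y
  ...   | true  = inj₂ (Y , refl , F₀Y)
  ...   | false = inj₁ (≡.trans (extendAt-insertAt v F₀ P Y true) F₀⊕PY)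

  module _ (A₀ : Subset n) where

    private
      A : Subset (suc n)
      A = insertAt A₀ v false
      d : Subset n → ℕ
      d Y = card (Y △ A₀)

    distance-insertAt : ∀ Y b → card (insertAt Y v b △ A) ≡ card (b ∷ (Y △ A₀))
    distance-insertAt Y b = ≡.trans (cong card (insertAt-△ Y A₀ v b false))
      (≡.trans (card-insertAt (Y △ A₀) v (b xor false)) (cong (λ b' → card (b' ∷ (Y △ A₀))) (xor-identityʳ b)))

    F₀-P-distance-≢ : ∀ Y Y' → F₀ Y ≡ true → P Y' ≡ true → d Y ≢ d Y'
    F₀-P-distance-≢ Y Y' F₀Y PY' dY≡dY' = p≢p⁻¹ (parity (card A₀)) (begin
      parity (card A₀)                   ≡⟨ cong (ℙ._+ parity (card A₀)) (sym (F₀-even Y F₀Y)) ⟩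
      parity (card Y) ℙ.+ parity (card A₀)  ≡⟨ sym (parity-card-△ Y A₀) ⟩
      parity (d Y)                       ≡⟨ cong parity dY≡dY' ⟩
      parity (d Y')                      ≡⟨ parity-card-△ Y' A₀ ⟩
      parity (card Y') ℙ.+ parity (card A₀) ≡⟨ cong (ℙ._+ parity (card A₀)) (P-odd Y' PY') ⟩
      parity (card A₀) ⁻¹                ∎)
      where open ≡-Reasoning

    P-near-distance : ∀ Y → P Y ≡ true → ∃[ Y' ] F₀ Y' ≡ true × d Y ≤ suc (d Y') × d Y' ≤ suc (d Y)
    P-near-distance Y PY with P-near Y PY
    ... | c , _ , F₀Y' = Y [ c ]≔ false , F₀Y'
      , ≡.subst (λ Z → d Y ≤ suc (card Z)) (sym ([]≔-△ Y A₀ c false)) (card-≤-[]≔ (Y △ A₀) c _)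
      , ≡.subst (λ Z → card Z ≤ suc (d Y)) (sym ([]≔-△ Y A₀ c false)) (card-[]≔-≤ (Y △ A₀) c _)

    module _ {l h} (min₀ : IsMinDistance F₀ A₀ l) (max₀ : IsMaxDistance F₀ A₀ h) where

      private
        Yₕ = proj₁ (proj₁ max₀)
        F₀Yₕ = proj₁ (proj₂ (proj₁ max₀))
        dYₕ≡h = proj₂ (proj₂ (proj₁ max₀))
        l≤ = proj₂ min₀
        ≤h = proj₂ max₀
        l≤h : l ≤ h
        l≤h = ≡.subst (l ≤_) dYₕ≡h (l≤ Yₕ F₀Yₕ)
        open ≡-Reasoning

      G₀-attains : ∀ {k} → Attains F₀ A₀ k → Attains G₀ A k
      G₀-attains (Y , F₀Y , dY≡k) =
        insertAt Y v false , ≡.trans (extendAt-insertAt v F₀ P Y false) F₀Y , ≡.trans (distance-insertAt Y false) dY≡k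

      G₁-attains : ∀ {k} → Attains G₀ A k → Attains G₁ A k
      G₁-attains (X , G₀X , dX≡k) = X , G₀⇒G₁ X G₀X , dX≡k

      G₀-lower : LowerBound G₀ A l
      G₀-lower X G₀X with extendAt-cases v F₀ P X G₀X
      ... | inj₁ (Y , refl , F₀Y) = ≡.subst (l ≤_) (sym (distance-insertAt Y false)) (l≤ Y F₀Y)
      ... | inj₂ (Y , refl , PY) with P-near-distance Y PY
      ...   | Y' , F₀Y' , _ , dY'≤1+dY =
        ≡.subst (l ≤_) (sym (distance-insertAt Y true)) (≤-trans (l≤ Y' F₀Y') dY'≤1+dY)

      G₁-lower : LowerBound G₁ A l
      G₁-lower X G₁X with G₁-cases X G₁X
      ... | inj₁ G₀X            = G₀-lower X G₀X
      ... | inj₂ (Y , refl , F₀Y) =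
        ≡.subst (l ≤_) (sym (distance-insertAt Y true)) (≤-trans (l≤ Y F₀Y) (n≤1+n _))

      G₀-min : IsMinDistance G₀ A l
      G₀-min = G₀-attains (proj₁ min₀) , G₀-lower

      G₁-min : IsMinDistance G₁ A l
      G₁-min = G₁-attains (proj₁ G₀-min) , G₁-lower

      h≤G₀-max : ∀ {H} → UpperBound G₀ A H → h ≤ H
      h≤G₀-max {H} ≤H with G₀-attains (proj₁ max₀)
      ... | X , G₀X , dX≡h = ≡.subst (_≤ H) dX≡h (≤H X G₀X)

      -- A feasible set Y + v of G₀ is one step away from a feasible set of F₀, and |Y| has the
      -- opposite parity to the sets of F₀, so its distance to A is at most h + 2 but never h + 1.
      G₀-max-cases : ∀ {H} → IsMaxDistance G₀ A H → H ≡ h ⊎ H ≡ 2 + h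
      G₀-max-cases {H} ((X , G₀X , dX≡H) , ≤H) with extendAt-cases v F₀ P X G₀X
      ... | inj₁ (Y , refl , F₀Y) = inj₁ (≤-antisym
        (≡.subst (_≤ h) (≡.trans (sym (distance-insertAt Y false)) dX≡H) (≤h Y F₀Y)) (h≤G₀-max ≤H))
      ... | inj₂ (Y , refl , PY) with P-near-distance Y PY
      ...   | Y' , F₀Y' , dY≤1+dY' , _ = h≤x≤2+h⇒x≢1+h⇒x≡h∨x≡2+h (h≤G₀-max ≤H)
        (≡.subst (_≤ 2 + h) (≡.trans (sym (distance-insertAt Y true)) dX≡H)
                 (s≤s (≤-trans dY≤1+dY' (s≤s (≤h Y' F₀Y')))))
        (λ H≡1+h → F₀-P-distance-≢ Yₕ Y F₀Yₕ PY (≡.trans dYₕ≡h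
          (suc-injective (sym (≡.trans (sym (distance-insertAt Y true)) (≡.trans dX≡H H≡1+h))))))

      G₁-upper : ∀ {H H'} → UpperBound G₀ A H → H ≤ H' → suc h ≤ H' → UpperBound G₁ A H'
      G₁-upper {H' = H'} ≤H H≤H' 1+h≤H' X G₁X with G₁-cases X G₁X
      ... | inj₁ G₀X              = ≤-trans (≤H X G₀X) H≤H'
      ... | inj₂ (Y , refl , F₀Y) =
        ≡.subst (_≤ H') (sym (distance-insertAt Y true)) (≤-trans (s≤s (≤h Y F₀Y)) 1+h≤H')

      twist-identity-avoiding : ∀ z →
        (z + 1) * z ^ width (G₁ *tw A) ≡ z * z ^ width (G₀ *tw A) + z ^ 2 * z ^ width (F₀ *tw A₀)
      twist-identity-avoiding z with maxDistance G₀ A (proj₁ G₀-min)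
      ... | H , max@(_ , ≤H) with G₀-max-cases max
      ... | inj₁ refl = begin
        (z + 1) * z ^ width (G₁ *tw A)
          ≡⟨ cong (λ w → (z + 1) * z ^ w) (≡.trans (width-twist G₁ A G₁-min G₁-max) (+-∸-assoc 1 l≤h)) ⟩
        (z + 1) * z ^ suc (h ∸ l)
          ≡⟨ twist-identity-shift z (h ∸ l) ⟩
        z * z ^ (h ∸ l) + z ^ 2 * z ^ (h ∸ l)
          ≡⟨ sym (cong₂ (λ w w₀ → z * z ^ w + z ^ 2 * z ^ w₀)
               (width-twist G₀ A G₀-min max) (width-twist F₀ A₀ min₀ max₀)) ⟩
        z * z ^ width (G₀ *tw A) + z ^ 2 * z ^ width (F₀ *tw A₀)
          ∎
        where
        G₁-max : IsMaxDistance G₁ A (suc h)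
        G₁-max = (insertAt Yₕ v true , G₁-lift Yₕ F₀Yₕ , ≡.trans (distance-insertAt Yₕ true) (cong suc dYₕ≡h))
               , G₁-upper ≤H (n≤1+n h) ≤-refl
      ... | inj₂ refl = begin
        (z + 1) * z ^ width (G₁ *tw A)
          ≡⟨ cong (λ w → (z + 1) * z ^ w) (≡.trans (width-twist G₁ A G₁-min G₁-max) (+-∸-assoc 2 l≤h)) ⟩
        (z + 1) * z ^ (2 + (h ∸ l))
          ≡⟨ twist-identity-jump z (h ∸ l) ⟩
        z * z ^ (2 + (h ∸ l)) + z ^ 2 * z ^ (h ∸ l)
          ≡⟨ sym (cong₂ (λ w w₀ → z * z ^ w + z ^ 2 * z ^ w₀)
               (≡.trans (width-twist G₀ A G₀-min max) (+-∸-assoc 2 l≤h)) (width-twist F₀ A₀ min₀ max₀)) ⟩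
        z * z ^ width (G₀ *tw A) + z ^ 2 * z ^ width (F₀ *tw A₀)
          ∎
        where
        G₁-max : IsMaxDistance G₁ A (2 + h)
        G₁-max = G₁-attains (proj₁ max) , G₁-upper ≤H ≤-refl (n≤1+n (suc h))

  TwistIdentity : ℕ → Subset (suc n) → Subset n → Set
  TwistIdentity z A A₀ =
    (z + 1) * z ^ width (G₁ *tw A) ≡ z * z ^ width (G₀ *tw A) + z ^ 2 * z ^ width (F₀ *tw A₀)

  private
    ∅ = replicate n false
    G₀-∅ : G₀ (insertAt ∅ v false) ≡ true
    G₀-∅ = ≡.trans (extendAt-insertAt v F₀ P ∅ false) F₀-∅
    G₁-∅ : G₁ (insertAt ∅ v false) ≡ true
    G₁-∅ = G₀⇒G₁ (insertAt ∅ v false) G₀-∅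

  twist-identity-∁ : ∀ z A A₀ → TwistIdentity z (∁ A) (∁ A₀) → TwistIdentity z A A₀
  twist-identity-∁ z A A₀ identity = begin
    (z + 1) * z ^ width (G₁ *tw A)
      ≡⟨ cong (λ w → (z + 1) * z ^ w) (sym (width-∁ G₁ A (insertAt ∅ v false , G₁-∅ , refl))) ⟩
    (z + 1) * z ^ width (G₁ *tw ∁ A)
      ≡⟨ identity ⟩
    z * z ^ width (G₀ *tw ∁ A) + z ^ 2 * z ^ width (F₀ *tw ∁ A₀)
      ≡⟨ cong₂ (λ w w₀ → z * z ^ w + z ^ 2 * z ^ w₀)
           (width-∁ G₀ A (insertAt ∅ v false , G₀-∅ , refl)) (width-∁ F₀ A₀ (∅ , F₀-∅ , refl)) ⟩
    z * z ^ width (G₀ *tw A) + z ^ 2 * z ^ width (F₀ *tw A₀)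
      ∎
    where open ≡-Reasoning

  twist-identity : ∀ z A → TwistIdentity z A (removeAt A v)
  twist-identity z A = ≡.subst (λ B → TwistIdentity z B (removeAt A v)) (insertAt-removeAt A v) (by-v (lookup A v))
    where
    avoiding : ∀ A₀ → TwistIdentity z (insertAt A₀ v false) A₀
    avoiding A₀ with minDistance F₀ A₀ (∅ , F₀-∅ , refl) | maxDistance F₀ A₀ (∅ , F₀-∅ , refl)
    ... | _ , min₀ | _ , max₀ = twist-identity-avoiding A₀ min₀ max₀ z
    by-v : ∀ b → TwistIdentity z (insertAt (removeAt A v) v b) (removeAt A v)
    by-v false = avoiding (removeAt A v)
    by-v true  = twist-identity-∁ z _ _ (≡.subst (λ B → TwistIdentity z B (∁ (removeAt A v)))
      (sym (map-insertAt not true (removeAt A v) v)) (avoiding (∁ (removeAt A v))))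

  twistPoly-identity : ∀ z → (z + 1) * twistPoly G₁ z ≡ z * twistPoly G₀ z + 2 * z ^ 2 * twistPoly F₀ z
  twistPoly-identity z = begin
    (z + 1) * ∑ₛ (λ A → z ^ width (G₁ *tw A))
      ≡⟨ *-distribˡ-∑ₛ (z + 1) (λ A → z ^ width (G₁ *tw A)) ⟩
    ∑ₛ (λ A → (z + 1) * z ^ width (G₁ *tw A))
      ≡⟨ ∑ₛ-cong (twist-identity z) ⟩
    ∑ₛ (λ A → z * z ^ width (G₀ *tw A) + z ^ 2 * z ^ width (F₀ *tw removeAt A v))
      ≡⟨ ∑ₛ-+ (λ A → z * z ^ width (G₀ *tw A)) (λ A → z ^ 2 * z ^ width (F₀ *tw removeAt A v)) ⟩
    ∑ₛ (λ A → z * z ^ width (G₀ *tw A)) + ∑ₛ (λ A → z ^ 2 * z ^ width (F₀ *tw removeAt A v))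
      ≡⟨ cong₂ _+_ (sym (*-distribˡ-∑ₛ z (λ A → z ^ width (G₀ *tw A))))
                   (sym (*-distribˡ-∑ₛ (z ^ 2) (λ A → z ^ width (F₀ *tw removeAt A v)))) ⟩
    z * twistPoly G₀ z + z ^ 2 * ∑ₛ (λ A → z ^ width (F₀ *tw removeAt A v))
      ≡⟨ cong (λ t → z * twistPoly G₀ z + z ^ 2 * t) (∑ₛ-removeAt v (λ A₀ → z ^ width (F₀ *tw A₀))) ⟩
    z * twistPoly G₀ z + z ^ 2 * (2 * twistPoly F₀ z)
      ≡⟨ cong (z * twistPoly G₀ z +_) (regroup (z ^ 2) (twistPoly F₀ z)) ⟩
    z * twistPoly G₀ z + 2 * z ^ 2 * twistPoly F₀ z
      ∎
    where
    open ≡-Reasoning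
    regroup : ∀ a b → a * (2 * b) ≡ 2 * a * b
    regroup = solve-∀

module _ {n} (G : Graph n) where

  adjMatrix-symmetric : Symmetric (adjMatrix G)
  adjMatrix-symmetric u w with u ≟ w | w ≟ u
  ... | yes refl | yes _    = refl
  ... | yes refl | no  w≢w  = contradiction refl w≢w
  ... | no  u≢u  | yes refl = contradiction refl u≢u
  ... | no  _    | no  _    = adjSym G u w

  adjMatrix-diagonal : ∀ u → adjMatrix G u u ≡ loop G u
  adjMatrix-diagonal u with u ≟ u
  ... | yes _   = refl
  ... | no  u≢u = contradiction refl u≢u

  D-∅ : D G (replicate n false) ≡ true
  D-∅ rewrite elems-empty n = refl

  -- Over F₂ a symmetric matrix with zero diagonal is alternating, so its odd principal minors vanish.
  D-even : Loopless G → ∀ Y → D G Y ≡ true → parity (card Y) ≡ 0ℙ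
  D-even loopless Y DY with parity (card Y) in |Y|-parity
  ... | 0ℙ = refl
  ... | 1ℙ = contradiction (≡.trans (sym DY) (detF2-odd (adjMatrix G) adjMatrix-symmetric
    (λ u → ≡.trans (adjMatrix-diagonal u) (loopless u)) (card Y) (elems Y) (length-elems Y) |Y|-parity)) λ ()

module _ {n} (G : Graph (suc n)) (v : Fin (suc n)) where

  private
    M = adjMatrix G
    pᵥ = punchIn v

  adjMatrix-─ : ∀ i j → adjMatrix (G ─ v) i j ≡ M (pᵥ i) (pᵥ j)
  adjMatrix-─ i j with i ≟ j | pᵥ i ≟ pᵥ j
  ... | yes refl | yes _   = refl
  ... | yes refl | no  ≢   = contradiction refl ≢
  ... | no  i≢j  | yes eq  = contradiction (punchIn-injective v i j eq) i≢j
  ... | no  _    | no  _   = refl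

  detF2-─ : ∀ rs cs → detF2 M (map pᵥ rs) (map pᵥ cs) ≡ detF2 (adjMatrix (G ─ v)) rs cs
  detF2-─ rs cs = ≡.trans (detF2-map M pᵥ rs cs) (detF2-cong _ _ (λ i j → sym (adjMatrix-─ i j)) rs cs)

  D-insertAt-false : ∀ Y → D G (insertAt Y v false) ≡ D (G ─ v) Y
  D-insertAt-false Y = ≡.trans (cong (λ L → detF2 M L L) (elems-insertAt-false Y v)) (detF2-─ (elems Y) (elems Y))

  D-insertAt-true : ∀ Y → D G (insertAt Y v true) ≡ detF2 M (v ∷ map pᵥ (elems Y)) (v ∷ map pᵥ (elems Y))
  D-insertAt-true Y = detF2-principal-↭ M (adjMatrix-symmetric G) (elems-insertAt-true Y v)

  D-insertAt-true-expand : Loopless G → ∀ Y → D G (insertAt Y v true) ≡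
    ⨁ (picks (elems Y)) (λ p → M v (pᵥ (proj₁ p)) ∧ detF2 M (map pᵥ (proj₂ p)) (map pᵥ (proj₂ p)))
  D-insertAt-true-expand loopless Y = begin
    D G (insertAt Y v true)
      ≡⟨ D-insertAt-true Y ⟩
    detF2 M (v ∷ map pᵥ (elems Y)) (v ∷ map pᵥ (elems Y))
      ≡⟨ detF2-principal-expand M (adjMatrix-symmetric G) v
           (≡.trans (adjMatrix-diagonal G v) (loopless v)) (map pᵥ (elems Y)) ⟩
    ⨁ (picks (map pᵥ (elems Y))) (λ p → M v (proj₁ p) ∧ detF2 M (proj₂ p) (proj₂ p))
      ≡⟨ ⨁-picks-map pᵥ (elems Y) (λ p → M v (proj₁ p) ∧ detF2 M (proj₂ p) (proj₂ p)) ⟩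
    ⨁ (picks (elems Y)) (λ p → M v (pᵥ (proj₁ p)) ∧ detF2 M (map pᵥ (proj₂ p)) (map pᵥ (proj₂ p)))
      ∎
    where open ≡-Reasoning

  D-insertAt-true-near : Loopless G → ∀ Y → D G (insertAt Y v true) ≡ true →
    ∃[ c ] card Y ≡ suc (card (Y [ c ]≔ false)) × D (G ─ v) (Y [ c ]≔ false) ≡ true
  D-insertAt-true-near loopless Y DY
    with ⨁-witness _ (All.zip (picks-elems Y , picks-length (elems Y))) (≡.trans (sym (D-insertAt-true-expand loopless Y)) DY)
  ... | (c , R) , (R≡ , 1+|R|≡) , term = c , card≡ , ≡.subst (λ R → detF2 (adjMatrix (G ─ v)) R R ≡ true) R≡
    (≡.trans (sym (detF2-─ R R)) (∧-conicalʳ (M v (pᵥ c)) _ term))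
    where
    card≡ : card Y ≡ suc (card (Y [ c ]≔ false))
    card≡ = begin
      card Y                         ≡⟨ sym (length-elems Y) ⟩
      length (elems Y)               ≡⟨ sym 1+|R|≡ ⟩
      suc (length R)                 ≡⟨ cong (suc ∘ length) R≡ ⟩
      suc (length (elems (Y [ c ]≔ false))) ≡⟨ cong suc (length-elems (Y [ c ]≔ false)) ⟩
      suc (card (Y [ c ]≔ false))    ∎
      where open ≡-Reasoning

module _ {n} (G : Graph (suc n)) (v : Fin (suc n)) where

  private
    M = adjMatrix G
    M⁺ = adjMatrix (G +ℓ v)
    pᵥ = punchIn v

  adjMatrix-+ℓ : ∀ r c → r ≢ v → M⁺ r c ≡ M r c
  adjMatrix-+ℓ r c r≢v with r ≟ c
  ... | no  _    = refl
  ... | yes refl with r ≟ v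
  ...   | yes r≡v = contradiction r≡v r≢v
  ...   | no  _   = refl

  adjMatrix-+ℓ-loop : M⁺ v v ≡ not (M v v)
  adjMatrix-+ℓ-loop = ≡.trans (adjMatrix-diagonal (G +ℓ v) v)
    (≡.trans (loop-+ℓ) (cong not (sym (adjMatrix-diagonal G v))))
    where
    loop-+ℓ : loop (G +ℓ v) v ≡ not (loop G v)
    loop-+ℓ with v ≟ v
    ... | yes _   = refl
    ... | no  v≢v = contradiction refl v≢v

  D-+ℓ-─ : ∀ Y → D ((G +ℓ v) ─ v) Y ≡ D (G ─ v) Y
  D-+ℓ-─ Y = detF2-cong _ _ (λ i j → ≡.trans (adjMatrix-─ (G +ℓ v) v i j)
    (≡.trans (adjMatrix-+ℓ (pᵥ i) (pᵥ j) (punchInᵢ≢i v i)) (sym (adjMatrix-─ G v i j)))) (elems Y) (elems Y)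

  -- Toggling the loop at v changes M[S + v] only in its (v, v) entry, which multiplies the minor M[S].
  D-+ℓ-insertAt-true : ∀ Y → D (G +ℓ v) (insertAt Y v true) ≡ D (G ─ v) Y xor D G (insertAt Y v true)
  D-+ℓ-insertAt-true Y = begin
    D (G +ℓ v) (insertAt Y v true)
      ≡⟨ ≡.trans (D-insertAt-true (G +ℓ v) v Y) (detF2-principal-∷ M⁺ (adjMatrix-symmetric (G +ℓ v)) v L) ⟩
    (M⁺ v v ∧ detF2 M⁺ L L) xor rest M⁺
      ≡⟨ cong₂ (λ m d → (m ∧ d) xor rest M⁺) adjMatrix-+ℓ-loop (≡.trans (detF2-cong-rows M⁺ M rows-L L) minor) ⟩
    (not (M v v) ∧ D (G ─ v) Y) xor rest M⁺
      ≡⟨ cong ((not (M v v) ∧ D (G ─ v) Y) xor_) rest-+ℓ ⟩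
    (not (M v v) ∧ D (G ─ v) Y) xor rest M
      ≡⟨ toggle (M v v) (D (G ─ v) Y) (rest M) ⟩
    D (G ─ v) Y xor ((M v v ∧ D (G ─ v) Y) xor rest M)
      ≡⟨ cong (λ d → D (G ─ v) Y xor ((M v v ∧ d) xor rest M)) (sym minor) ⟩
    D (G ─ v) Y xor ((M v v ∧ detF2 M L L) xor rest M)
      ≡⟨ cong (D (G ─ v) Y xor_)
           (sym (≡.trans (D-insertAt-true G v Y) (detF2-principal-∷ M (adjMatrix-symmetric G) v L))) ⟩
    D (G ─ v) Y xor D G (insertAt Y v true)
      ∎
    where
    open ≡-Reasoning
    L = map pᵥ (elems Y)
    rest : Matrix (suc n) → Bool
    rest N = ⨁ (picks L) (λ p → N v (proj₁ p) ∧ detF2 N L (v ∷ proj₂ p))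
    minor : detF2 M L L ≡ D (G ─ v) Y
    minor = detF2-─ G v (elems Y) (elems Y)
    rows-L : All (λ r → ∀ c → M⁺ r c ≡ M r c) L
    rows-L = map⁺ (All.universal (λ i c → adjMatrix-+ℓ (pᵥ i) c (punchInᵢ≢i v i)) (elems Y))
    columns-L : All (λ p → proj₁ p ≢ v) (picks L)
    columns-L = ≡.subst (All _) (sym (picks-map pᵥ (elems Y)))
      (map⁺ (All.universal (λ p → punchInᵢ≢i v (proj₁ p)) (picks (elems Y))))
    rest-+ℓ : rest M⁺ ≡ rest M
    rest-+ℓ = ⨁-cong-local (All.map (λ {p} c≢v → cong₂ _∧_
      (≡.trans (adjMatrix-symmetric (G +ℓ v) v (proj₁ p))
        (≡.trans (adjMatrix-+ℓ (proj₁ p) v c≢v) (adjMatrix-symmetric G (proj₁ p) v)))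
      (detF2-cong-rows M⁺ M rows-L (v ∷ proj₂ p))) columns-L)
    toggle : ∀ m d s → (not m ∧ d) xor s ≡ d xor ((m ∧ d) xor s)
    toggle false d s = refl
    toggle true  d s = sym (≡.trans (sym (xor-assoc d d s)) (cong (_xor s) (xor-same d)))

corollary4p5 : (n : ℕ) (G : Graph (suc n)) → Loopless G → (v : Fin (suc n)) →
    (z : ℕ) → (z + 1) * T (G +ℓ v) z ≡ z * T G z + 2 * z ^ 2 * T (G ─ v) z
corollary4p5 n G loopless v z = begin
  (z + 1) * T (G +ℓ v) z
    ≡⟨ cong ((z + 1) *_) (twistPoly-cong D⁺≗G₁ z) ⟩
  (z + 1) * twistPoly G₁ z
    ≡⟨ twistPoly-identity z ⟩
  z * twistPoly G₀ z + 2 * z ^ 2 * T (G ─ v) z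
    ≡⟨ cong (λ t → z * t + 2 * z ^ 2 * T (G ─ v) z) (sym (twistPoly-cong D≗G₀ z)) ⟩
  z * T G z + 2 * z ^ 2 * T (G ─ v) z
    ∎
  where
  open ≡-Reasoning
  F₀ P : SetSystem n
  F₀ = D (G ─ v)
  P Y = D G (insertAt Y v true)
  open OnePointExtension v F₀ P (D-∅ (G ─ v)) (D-even (G ─ v) (loopless ∘ punchIn v)) (D-insertAt-true-near G v loopless)
  D≗G₀ : ∀ X → D G X ≡ G₀ X
  D≗G₀ = extendAt-unique v F₀ P (D G) λ { Y false → D-insertAt-false G v Y ; Y true → refl }
  D⁺≗G₁ : ∀ X → D (G +ℓ v) X ≡ G₁ X
  D⁺≗G₁ = extendAt-unique v F₀ P⁺ (D (G +ℓ v)) λ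
    { Y false → ≡.trans (D-insertAt-false (G +ℓ v) v Y) (D-+ℓ-─ G v Y)
    ; Y true  → D-+ℓ-insertAt-true G v Y }
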